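{- Let $q$ be a positive integer and let $b_i=\binom{i}{q}$ for $i=1,2,\ldots$. Then for every positive integer $n$, \[C^{(\mathbf b)}(n)=\sum_{k=1}^n\binom{n+k-1}{qk+k-1}.\]
   Context: Given a sequence $\mathbf b=(b_1,b_2,\ldots)$ of nonnegative integers and positive integers $n,k$, $C^{(\mathbf b)}(n,k)=\sum b_{i_1}\cdots b_{i_k}$, the sum over all $k$-tuples of positive integers with sum $n$, and $C^{(\mathbf b)}(n)=\sum_{k=1}^nC^{(\mathbf b)}(n,k)$ (number of all compositions of $n$ where a part equal to $j$ comes in $b_j$ types). Binomial coefficients $\binom{a}{b}$ are $0$ when $a<b$. -}

module Defs where

open import Data.Nat using (ℕ; zero; suc; _+_; _*_; _∸_)
open import Data.List using (List; []; _∷_; map; concatMap; length; filterᵇ; upTo)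
open import Data.Nat using (_≡ᵇ_)
open import Data.Nat.ListAction using (sum; product)

sumFrom1 : ℕ → (ℕ → ℕ) → ℕ
sumFrom1 zero    f = 0
sumFrom1 (suc n) f = sumFrom1 n f + f (suc n)

-- All compositions of n: lists of positive integers (parts) summing to n,
-- enumerated by the first part j ∈ {1..n}.  (Well-founded via fuel = n.)
compsFuel : ℕ → ℕ → List (List ℕ)
compsFuel fuel    zero    = [] ∷ []
compsFuel zero    (suc n) = []
compsFuel (suc f) (suc n) =
  concatMap (λ j → map (λ c → suc j ∷ c) (compsFuel f (suc n ∸ suc j))) (upTo (suc n))

compositions : ℕ → List (List ℕ)
compositions n = compsFuel n n

Cbnk : (ℕ → ℕ) → ℕ → ℕ → ℕ
Cbnk b n k = sum (map (λ c → product (map b c))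
                     (filterᵇ (λ c → length c ≡ᵇ k) (compositions n)))

Cbn : (ℕ → ℕ) → ℕ → ℕ
Cbn b n = sumFrom1 n (λ k → Cbnk b n k)

module Submission where

-- For a weight sequence b, C^(b)(n,k) counts compositions of n into k parts
-- where a part j comes in b j types.  Splitting off the first part j gives the
-- recurrence  C(n,k+1) = Σ_{j=1}^{n} b j · C(n-j,k),  C(0,0) = 1,  C(n+1,0) = 0,
-- which we take as the definition of 'weightedComps' and show to agree with the
-- list-based 'Cbnk' of Defs by computing the weight of the enumeration
-- 'compsFuel' first part by first part.
--
-- For b i = (i choose a) with a ≥ 1 the recurrence becomes a Vandermonde
-- convolution  Σ_{i ≤ m} (i choose a)(m-i choose c) = (m+1 choose a+c+1),
-- and induction on k yields the closed form
--   C(n, k+1) = (n+k choose a(k+1)+k).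

open import Defs
open import Data.Nat using (ℕ; suc; _≤_; _+_; _*_; _∸_)
open import Data.Nat.Combinatorics using (_C_)
open import Relation.Binary.PropositionalEquality using (_≡_)

open import Data.Nat using (zero; _<_; s≤s; _≡ᵇ_)
open import Data.Nat.Properties
open import Data.Nat.Combinatorics using (k>n⇒nCk≡0; nCk+nC[k+1]≡[n+1]C[k+1])
open import Data.Nat.ListAction using (sum; product)
open import Data.List using (List; []; _∷_; map; concatMap; length; filterᵇ; upTo; _++_; applyUpTo)
open import Data.Bool using (true; false)
open import Algebra.Properties.CommutativeSemigroup +-commutativeSemigroup using (interchange)
open import Relation.Binary.PropositionalEquality using (refl; sym; trans; cong; cong₂)
open Relation.Binary.PropositionalEquality.≡-Reasoning

sumBelow : ℕ → (ℕ → ℕ) → ℕ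
sumBelow zero    f = 0
sumBelow (suc n) f = sumBelow n f + f n

sumBelow-cong : ∀ n {f g : ℕ → ℕ} → (∀ i → i < n → f i ≡ g i) →
                sumBelow n f ≡ sumBelow n g
sumBelow-cong zero    eq = refl
sumBelow-cong (suc n) eq =
  cong₂ _+_ (sumBelow-cong n (λ i i<n → eq i (m<n⇒m<1+n i<n))) (eq n ≤-refl)

sumBelow-zero : ∀ n (f : ℕ → ℕ) → (∀ i → i < n → f i ≡ 0) → sumBelow n f ≡ 0
sumBelow-zero zero    f vanish = refl
sumBelow-zero (suc n) f vanish =
  cong₂ _+_ (sumBelow-zero n f (λ i i<n → vanish i (m<n⇒m<1+n i<n))) (vanish n ≤-refl)

sumBelow-+ : ∀ n (f g : ℕ → ℕ) →
             sumBelow n (λ i → f i + g i) ≡ sumBelow n f + sumBelow n g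
sumBelow-+ zero    f g = refl
sumBelow-+ (suc n) f g = trans (cong (_+ (f n + g n)) (sumBelow-+ n f g))
                               (interchange (sumBelow n f) (sumBelow n g) (f n) (g n))

sumBelow-shift : ∀ n (h : ℕ → ℕ) →
                 sumBelow (suc n) h ≡ h 0 + sumBelow n (λ j → h (suc j))
sumBelow-shift zero    h = +-comm 0 (h 0)
sumBelow-shift (suc n) h =
  trans (cong (_+ h (suc n)) (sumBelow-shift n h)) (+-assoc (h 0) _ _)

sumBelow-extend : ∀ n k (f : ℕ → ℕ) → (∀ j → n ≤ j → f j ≡ 0) →
                  sumBelow (n + k) f ≡ sumBelow n f
sumBelow-extend n zero    f vanish = cong (λ m → sumBelow m f) (+-identityʳ n)
sumBelow-extend n (suc k) f vanish rewrite +-suc n k =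
  trans (cong₂ _+_ (sumBelow-extend n k f vanish) (vanish (n + k) (m≤m+n n k)))
        (+-identityʳ _)

sum-applyUpTo : ∀ n (f g : ℕ → ℕ) →
                sum (map f (applyUpTo g n)) ≡ sumBelow n (λ j → f (g j))
sum-applyUpTo zero    f g = refl
sum-applyUpTo (suc n) f g =
  trans (cong (f (g 0) +_) (sum-applyUpTo n f (λ j → g (suc j))))
        (sym (sumBelow-shift n (λ j → f (g j))))

sumFrom1-cong : ∀ n (f g : ℕ → ℕ) → (∀ i → f (suc i) ≡ g (suc i)) →
                sumFrom1 n f ≡ sumFrom1 n g
sumFrom1-cong zero    f g eq = refl
sumFrom1-cong (suc n) f g eq = cong₂ _+_ (sumFrom1-cong n f g eq) (eq n)

module WeightedCompositions (b : ℕ → ℕ) where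

  weightedComps : ℕ → ℕ → ℕ
  weightedComps n       (suc k) = sumBelow n (λ j → b (suc j) * weightedComps (n ∸ suc j) k)
  weightedComps zero    zero    = 1
  weightedComps (suc n) zero    = 0

  weightedComps-one : ∀ n → weightedComps (suc n) 1 ≡ b (suc n)
  weightedComps-one n =
    cong₂ _+_ (sumBelow-zero n _ (λ j j<n →
                 trans (cong (b (suc j) *_) (no-empty n j j<n)) (*-zeroʳ (b (suc j)))))
              (trans (cong (b (suc n) *_) (empty n)) (*-identityʳ (b (suc n))))
    where
    no-empty : ∀ n j → j < n → weightedComps (n ∸ j) 0 ≡ 0
    no-empty (suc n) zero    _         = refl
    no-empty (suc n) (suc j) (s≤s j<n) = no-empty n j j<n
    empty : ∀ n → weightedComps (n ∸ n) 0 ≡ 1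
    empty zero    = refl
    empty (suc n) = empty n

  weight : ℕ → List (List ℕ) → ℕ
  weight k L = sum (map (λ c → product (map b c)) (filterᵇ (λ c → length c ≡ᵇ k) L))

  weight-++ : ∀ k xs ys → weight k (xs ++ ys) ≡ weight k xs + weight k ys
  weight-++ k []       ys = refl
  weight-++ k (x ∷ xs) ys with length x ≡ᵇ k
  ... | true  = trans (cong (product (map b x) +_) (weight-++ k xs ys))
                      (sym (+-assoc (product (map b x)) _ _))
  ... | false = weight-++ k xs ys

  weight-concatMap : ∀ k (g : ℕ → List (List ℕ)) xs →
                     weight k (concatMap g xs) ≡ sum (map (λ x → weight k (g x)) xs)
  weight-concatMap k g []       = refl
  weight-concatMap k g (x ∷ xs) =
    trans (weight-++ k (g x) (concatMap g xs)) (cong (weight k (g x) +_) (weight-concatMap k g xs))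

  weight-cons-zero : ∀ x L → weight 0 (map (x ∷_) L) ≡ 0
  weight-cons-zero x []      = refl
  weight-cons-zero x (c ∷ L) = weight-cons-zero x L

  weight-cons-suc : ∀ k x L → weight (suc k) (map (x ∷_) L) ≡ b x * weight k L
  weight-cons-suc k x []      = sym (*-zeroʳ (b x))
  weight-cons-suc k x (c ∷ L) with length c ≡ᵇ k
  ... | true  = trans (cong (b x * product (map b c) +_) (weight-cons-suc k x L))
                      (sym (*-distribˡ-+ (b x) _ _))
  ... | false = weight-cons-suc k x L

  weight-compsFuel : ∀ fuel n k → n ≤ fuel → weight k (compsFuel fuel n) ≡ weightedComps n k
  weight-compsFuel fuel       zero    zero    _         = refl
  weight-compsFuel fuel       zero    (suc k) _         = refl
  weight-compsFuel (suc fuel) (suc n) k       (s≤s n≤f) = begin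
    weight k (concatMap byFirst (upTo (suc n)))
      ≡⟨ weight-concatMap k byFirst (upTo (suc n)) ⟩
    sum (map (λ j → weight k (byFirst j)) (upTo (suc n)))
      ≡⟨ sum-applyUpTo (suc n) (λ j → weight k (byFirst j)) (λ j → j) ⟩
    sumBelow (suc n) (λ j → weight k (byFirst j))
      ≡⟨ firstPart k ⟩
    weightedComps (suc n) k ∎
    where
    byFirst : ℕ → List (List ℕ)
    byFirst j = map (suc j ∷_) (compsFuel fuel (n ∸ j))
    firstPart : ∀ k → sumBelow (suc n) (λ j → weight k (byFirst j)) ≡ weightedComps (suc n) k
    firstPart zero    = sumBelow-zero (suc n) _
                          (λ j _ → weight-cons-zero (suc j) (compsFuel fuel (n ∸ j)))
    firstPart (suc k) = sumBelow-cong (suc n) (λ j _ →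
      trans (weight-cons-suc k (suc j) (compsFuel fuel (n ∸ j)))
            (cong (b (suc j) *_) (weight-compsFuel fuel (n ∸ j) k (≤-trans (m∸n≤m n j) n≤f))))

  Cbnk≡weightedComps : ∀ n k → Cbnk b n k ≡ weightedComps n k
  Cbnk≡weightedComps n k = weight-compsFuel n n k ≤-refl

vandermonde : ∀ m a c →
  sumBelow (suc m) (λ i → (i C a) * ((m ∸ i) C c)) ≡ suc m C suc (a + c)
vandermonde zero    zero    zero    = refl
vandermonde zero    zero    (suc c) = refl
vandermonde zero    (suc a) c       = refl
vandermonde (suc m) a zero = begin
  sumBelow (suc m) (λ i → (i C a) * ((suc m ∸ i) C 0)) + (suc m C a) * 1
    ≡⟨ cong₂ _+_ (vandermonde m a 0) (*-identityʳ _) ⟩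
  suc m C suc (a + 0) + suc m C a
    ≡⟨ cong (λ x → suc m C suc x + suc m C a) (+-identityʳ a) ⟩
  suc m C suc a + suc m C a
    ≡⟨ +-comm (suc m C suc a) _ ⟩
  suc m C a + suc m C suc a
    ≡⟨ nCk+nC[k+1]≡[n+1]C[k+1] (suc m) a ⟩
  suc (suc m) C suc a
    ≡⟨ cong (λ x → suc (suc m) C suc x) (sym (+-identityʳ a)) ⟩
  suc (suc m) C suc (a + 0) ∎
vandermonde (suc m) a (suc c) = begin
  sumBelow (suc m) (λ i → (i C a) * ((suc m ∸ i) C suc c)) + (suc m C a) * ((suc m ∸ suc m) C suc c)
    ≡⟨ cong₂ _+_ (sumBelow-cong (suc m) pascal) lastVanishes ⟩
  sumBelow (suc m) (λ i → (i C a) * ((m ∸ i) C c) + (i C a) * ((m ∸ i) C suc c)) + 0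
    ≡⟨ trans (+-identityʳ _) (sumBelow-+ (suc m) _ _) ⟩
  sumBelow (suc m) (λ i → (i C a) * ((m ∸ i) C c)) + sumBelow (suc m) (λ i → (i C a) * ((m ∸ i) C suc c))
    ≡⟨ cong₂ _+_ (vandermonde m a c) (vandermonde m a (suc c)) ⟩
  suc m C suc (a + c) + suc m C suc (a + suc c)
    ≡⟨ cong (λ x → suc m C x + suc m C suc (a + suc c)) (sym (+-suc a c)) ⟩
  suc m C (a + suc c) + suc m C suc (a + suc c)
    ≡⟨ nCk+nC[k+1]≡[n+1]C[k+1] (suc m) (a + suc c) ⟩
  suc (suc m) C suc (a + suc c) ∎
  where
  pascal : ∀ i → i < suc m →
    (i C a) * ((suc m ∸ i) C suc c) ≡ (i C a) * ((m ∸ i) C c) + (i C a) * ((m ∸ i) C suc c)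
  pascal i (s≤s i≤m) = begin
    (i C a) * ((suc m ∸ i) C suc c)
      ≡⟨ cong (λ x → (i C a) * (x C suc c)) (+-∸-assoc 1 i≤m) ⟩
    (i C a) * (suc (m ∸ i) C suc c)
      ≡⟨ cong ((i C a) *_) (sym (nCk+nC[k+1]≡[n+1]C[k+1] (m ∸ i) c)) ⟩
    (i C a) * ((m ∸ i) C c + (m ∸ i) C suc c)
      ≡⟨ *-distribˡ-+ (i C a) _ _ ⟩
    (i C a) * ((m ∸ i) C c) + (i C a) * ((m ∸ i) C suc c) ∎
  lastVanishes : (suc m C a) * ((suc m ∸ suc m) C suc c) ≡ 0
  lastVanishes = trans (cong (λ x → (suc m C a) * (x C suc c)) (n∸n≡0 (suc m)))
                       (*-zeroʳ (suc m C a))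

module BinomialWeights (p : ℕ) where
  open WeightedCompositions (λ i → i C suc p)

  lowerIndex : ℕ → ℕ
  lowerIndex k = suc p * suc k + k

  lowerIndex-suc : ∀ k → suc (suc p + lowerIndex k) ≡ lowerIndex (suc k)
  lowerIndex-suc k = begin
    suc (suc p + (suc p * suc k + k))   ≡⟨ cong suc (sym (+-assoc (suc p) _ k)) ⟩
    suc (suc p + suc p * suc k + k)     ≡⟨ sym (+-suc (suc p + suc p * suc k) k) ⟩
    suc p + suc p * suc k + suc k       ≡⟨ cong (_+ suc k) (sym (*-suc (suc p) (suc k))) ⟩
    suc p * suc (suc k) + suc k         ∎

  closedForm : ∀ k n → weightedComps n (suc k) ≡ (n + k) C lowerIndex k
  closedForm zero zero    = refl
  closedForm zero (suc n) = trans (weightedComps-one n)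
    (cong₂ _C_ (sym (+-identityʳ (suc n))) (sym (trans (+-identityʳ (suc p * 1)) (*-identityʳ (suc p)))))
  closedForm (suc k) n = begin
    sumBelow n (λ j → (suc j C suc p) * weightedComps (n ∸ suc j) (suc k))
      ≡⟨ sumBelow-cong n (λ j j<n → cong ((suc j C suc p) *_)
           (trans (closedForm k (n ∸ suc j)) (cong (_C lowerIndex k) (sym (+-∸-comm k j<n))))) ⟩
    sumBelow n term
      ≡⟨ sym (sumBelow-extend n k term term-vanishes) ⟩
    sumBelow (n + k) term
      ≡⟨ sym (sumBelow-shift (n + k) (λ i → (i C suc p) * ((n + k ∸ i) C lowerIndex k))) ⟩
    sumBelow (suc (n + k)) (λ i → (i C suc p) * ((n + k ∸ i) C lowerIndex k))
      ≡⟨ vandermonde (n + k) (suc p) (lowerIndex k) ⟩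
    suc (n + k) C suc (suc p + lowerIndex k)
      ≡⟨ cong₂ _C_ (sym (+-suc n k)) (lowerIndex-suc k) ⟩
    (n + suc k) C lowerIndex (suc k) ∎
    where
    -- The Vandermonde summand at i = j+1; its i = 0 term is 0 since a ≥ 1.
    term : ℕ → ℕ
    term j = (suc j C suc p) * ((n + k ∸ suc j) C lowerIndex k)
    -- For j ≥ n the upper index n+k-(j+1) is below k < lowerIndex k.
    term-vanishes : ∀ j → n ≤ j → term j ≡ 0
    term-vanishes j n≤j =
      trans (cong ((suc j C suc p) *_) (k>n⇒nCk≡0 upper<lower)) (*-zeroʳ (suc j C suc p))
      where
      upper≤k : n + k ∸ suc j ≤ k
      upper≤k = ≤-trans (∸-monoʳ-≤ (n + k) (m≤n⇒m≤1+n n≤j)) (≤-reflexive (m+n∸m≡n n k))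
      upper<lower : n + k ∸ suc j < lowerIndex k
      upper<lower = ≤-<-trans upper≤k (s≤s (m≤n+m k (k + p * suc k)))

corollary4 : (q : ℕ) → 1 ≤ q → (n : ℕ) → 1 ≤ n →
    Cbn (λ i → i C q) n ≡ sumFrom1 n (λ k → (n + k ∸ 1) C (q * k + k ∸ 1))
corollary4 (suc p) _ n _ = sumFrom1-cong n _ _ parts
  where
  open WeightedCompositions (λ i → i C suc p) using (weightedComps; Cbnk≡weightedComps)
  open BinomialWeights p using (closedForm)
  parts : ∀ k → Cbnk (λ i → i C suc p) n (suc k)
              ≡ (n + suc k ∸ 1) C (suc p * suc k + suc k ∸ 1)
  parts k = begin
    Cbnk (λ i → i C suc p) n (suc k)   ≡⟨ Cbnk≡weightedComps n (suc k) ⟩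
    weightedComps n (suc k)            ≡⟨ closedForm k n ⟩
    (n + k) C (suc p * suc k + k)      ≡⟨ cong₂ (λ x y → (x ∸ 1) C (y ∸ 1))
                                                (sym (+-suc n k)) (sym (+-suc (suc p * suc k) k)) ⟩
    (n + suc k ∸ 1) C (suc p * suc k + suc k ∸ 1) ∎
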